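{- Let $G=(V_G,E_G)$ and $H=(V_H,E_H)$ be finite simple connected graphs with $|V_G|\ge2$ and $|V_H|\ge2$. Then the antipodal graph $A(G\wr H)$ is connected if and only if $A(H)$ and $A_{Ha}(G)$ are connected and $A(H)$ is not bipartite.
   Context: The wreath product $G\wr H$ has vertex set $\{(f,v): f:V_G\to V_H,\ v\in V_G\}$; $(f,v)$ and $(f',v')$ are adjacent iff either $v=v'$, $f(w)=f'(w)$ for $w\neq v$ and $f(v)\sim f'(v)$ in $H$, or $f=f'$ and $v\sim v'$ in $G$. For a connected graph $X$, the antipodal graph $A(X)$ has vertex set $V_X$, with $u\sim v$ iff $d_X(u,v)=diam(X)$ ($d_X$ geodesic distance). For $u,v\in V_G$, $d_{Ha}(u,v)$ is the minimum length of a walk in $G$ from $u$ to $v$ (vertex repetitions allowed) visiting every vertex of $G$; $diam_{Ha}(G)=\max_{u,v}d_{Ha}(u,v)$; the Hamiltonian antipodal graph $A_{Ha}(G)$ has vertex set $V_G$, with $u$ and $v$ (possibly $u=v$, giving a loop) adjacent iff $d_{Ha}(u,v)=diam_{Ha}(G)$. -}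

module Defs where

open import Data.Nat using (ℕ; zero; suc; _≤_)
open import Data.Fin using (Fin)
open import Data.Vec using (Vec; lookup)
open import Data.List using (List; []; _∷_)
open import Data.List.Membership.Propositional using (_∈_)
open import Data.Product using (Σ; ∃; ∃-syntax; _×_; _,_)
open import Data.Sum using (_⊎_)
open import Data.Bool using (Bool)
open import Relation.Nullary using (¬_; Dec)
open import Relation.Binary.PropositionalEquality using (_≡_; _≢_)

record SimpleGraph (n : ℕ) : Set₁ where
  field
    Adj     : Fin n → Fin n → Set
    adj?    : ∀ u v → Dec (Adj u v)
    sym     : ∀ {u v} → Adj u v → Adj v u
    irrefl  : ∀ {u} → ¬ Adj u u
open SimpleGraph public

module _ {V : Set} (E : V → V → Set) where

  data Walk : V → V → ℕ → Set where
    [] : ∀ {u} → Walk u u zero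
    _∷_ : ∀ {u v w k} → E u v → Walk v w k → Walk u w (suc k)

  verts : ∀ {u v k} → Walk u v k → List V
  verts {u} [] = u ∷ []
  verts {u} (_∷_ e p) = u ∷ verts p

  Connected : Set
  Connected = ∀ u v → ∃[ k ] Walk u v k

  IsDist : V → V → ℕ → Set
  IsDist u v k = Walk u v k × (∀ m → Walk u v m → k ≤ m)

  IsDiam : ℕ → Set
  IsDiam D = (∀ u v k → IsDist u v k → k ≤ D) × (∃[ u ] ∃[ v ] IsDist u v D)

  Antipodal : V → V → Set
  Antipodal u v = ∃[ D ] (IsDiam D × IsDist u v D)

  VisitsAll : ∀ {u v k} → Walk u v k → Set
  VisitsAll p = ∀ w → w ∈ verts p

  IsHaDist : V → V → ℕ → Set
  IsHaDist u v k = (Σ (Walk u v k) VisitsAll)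
                 × (∀ m → (q : Walk u v m) → VisitsAll q → k ≤ m)

  IsHaDiam : ℕ → Set
  IsHaDiam D = (∀ u v k → IsHaDist u v k → k ≤ D) × (∃[ u ] ∃[ v ] IsHaDist u v D)

  -- Hamiltonian antipodal graph A_Ha (loops u ~ u allowed)
  HamAntipodal : V → V → Set
  HamAntipodal u v = ∃[ D ] (IsHaDiam D × IsHaDist u v D)

  Bipartite : Set
  Bipartite = Σ (V → Bool) (λ c → ∀ u v → E u v → c u ≢ c v)

-- Wreath product G ≀ H: vertices (f , v) with f : V_G → V_H (as a vector) and v ∈ V_G.
WreathAdj : ∀ {n m} → SimpleGraph n → SimpleGraph m
          → (Vec (Fin m) n × Fin n) → (Vec (Fin m) n × Fin n) → Set
WreathAdj G H (f , v) (f' , v') =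
    (v ≡ v' × (∀ w → w ≢ v → lookup f w ≡ lookup f' w) × Adj H (lookup f v) (lookup f' v))
  ⊎ (f ≡ f' × Adj G v v')

module Submission where

-- A walk in G ≀ H splits into a walk of the lamplighter in G, which must visit every vertex whose lamp
-- changes, and one walk in H per lamp; conversely such data can be replayed as a walk in G ≀ H. Hence
-- d((f,v),(f',v')) = d_Ha(v,v') + Σ_w d_H(f w, f' w) when all lamps differ, the diameter of G ≀ H is
-- diam_Ha(G) + |V_G| diam(H), and (f,v) ~ (f',v') in A(G ≀ H) iff f w ~ f' w in A(H) for every w and
-- v ~ v' in A_Ha(G). So A(G ≀ H) is the tensor product of |V_G| copies of A(H) with A_Ha(G), and a walk in
-- it is a family of walks of one common length. If A(H) is connected and has an odd closed walk, any two
-- of its vertices are joined by walks of every large length, and so are any two vertices of A_Ha(G) once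
-- it is connected with at least two vertices. If A(H) is properly 2-coloured by c, then
-- c(f w₀) = c(f w₁) is invariant along walks in A(G ≀ H), which separates two configurations.

open import Defs hiding (sym)
open import Data.Nat using (ℕ; zero; suc; _+_; _≤_; _<_; z≤n; s≤s; z<s; _≟_)
open import Data.Nat.Properties
open import Data.Product using (Σ; ∃; ∃₂; _×_; _,_; proj₁; proj₂; map₂)
open import Data.Bool using (Bool; true; false) renaming (_≟_ to _≟ᵇ_)
open import Data.Bool.Properties using (¬-not)
open import Data.Sum using (_⊎_; inj₁; inj₂; map₁; [_,_]′)
open import Data.Fin using (Fin; zero; suc; punchIn)
open import Data.Fin.Properties using (any?; all?; punchInᵢ≢i) renaming (_≟_ to _≟ᶠ_)
open import Data.List using (List; []; _∷_; allFin; cartesianProduct)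
open import Data.List.Membership.Propositional using (_∈_)
open import Data.List.Membership.Propositional.Properties using (∈-allFin; ∈-cartesianProduct⁺)
open import Data.List.Relation.Unary.Any using (here; there)
import Data.List.Relation.Unary.All as All
open import Data.List.Extrema.Nat using (argmax; f[xs]≤f[argmax])
open import Data.Nat.Tactic.RingSolver using (solve-∀)
open import Data.Vec using (Vec; lookup; _[_]≔_; replicate; tabulate)
open import Data.Vec.Properties using (lookup∘update; lookup∘update′; []≔-idempotent; []≔-lookup; lookup-replicate; lookup∘tabulate; tabulate∘lookup; tabulate-cong)
open import Data.Vec.Functional using (Vector; removeAt; updateAt)
open import Data.Vec.Functional.Properties using (updateAt-updates; updateAt-minimal)
open import Algebra.Properties.CommutativeMonoid.Sum +-0-commutativeMonoid using (sum; sum-cong-≗; sum-remove; sum-replicate-zero)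
open import Function using (_∘_; _⇔_; mk⇔; Equivalence)
open import Relation.Nullary using (¬_; Dec; yes; no; contradiction)
open import Relation.Nullary.Decidable using (map′; _×-dec_; _⊎-dec_)
open import Relation.Unary using (Decidable)
open import Relation.Binary.Definitions using (Symmetric)
open import Relation.Binary.PropositionalEquality using (_≡_; _≢_; refl; sym; trans; cong; subst; subst₂; cong₂; module ≡-Reasoning)

+-≤-≡-split : ∀ {a b c d} → a ≤ b → c ≤ d → a + c ≡ b + d → a ≡ b × c ≡ d
+-≤-≡-split {a} {b} {c} {d} a≤b c≤d eq = a≡b , +-cancelˡ-≡ b c d (trans (cong (_+ c) (sym a≡b)) eq)
  where
  a≡b : a ≡ b
  a≡b = ≤-antisym a≤b (+-cancelʳ-≤ c b a (≤-trans (+-mono-≤ (≤-refl {b}) c≤d) (≤-reflexive (sym eq))))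

sum-mono-≤ : ∀ {n} {f g : Vector ℕ n} → (∀ i → f i ≤ g i) → sum f ≤ sum g
sum-mono-≤ {zero} f≤g = z≤n
sum-mono-≤ {suc n} f≤g = +-mono-≤ (f≤g zero) (sum-mono-≤ (f≤g ∘ suc))

sum-≡⇒≗ : ∀ {n} {f g : Vector ℕ n} → (∀ i → f i ≤ g i) → sum f ≡ sum g → ∀ i → f i ≡ g i
sum-≡⇒≗ {suc n} f≤g eq zero = proj₁ (+-≤-≡-split (f≤g zero) (sum-mono-≤ (f≤g ∘ suc)) eq)
sum-≡⇒≗ {suc n} f≤g eq (suc i) = sum-≡⇒≗ (f≤g ∘ suc) (proj₂ (+-≤-≡-split (f≤g zero) (sum-mono-≤ (f≤g ∘ suc)) eq)) i

sum-exchange : ∀ {n} {f g : Vector ℕ n} v → (∀ w → w ≢ v → f w ≡ g w) → sum f + g v ≡ sum g + f v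
sum-exchange {suc n} {f} {g} v agree = begin
  sum f + g v                         ≡⟨ cong (_+ g v) (sum-remove {i = v} f) ⟩
  f v + sum (removeAt f v) + g v      ≡⟨ cong (λ r → f v + r + g v) (sum-cong-≗ λ j → agree _ (punchInᵢ≢i v j)) ⟩
  f v + sum (removeAt g v) + g v      ≡⟨ swap-outer (f v) (sum (removeAt g v)) (g v) ⟩
  g v + sum (removeAt g v) + f v      ≡⟨ cong (_+ f v) (sum-remove {i = v} g) ⟨
  sum g + f v                         ∎
  where
  open ≡-Reasoning
  swap-outer : ∀ a r b → a + r + b ≡ b + r + a
  swap-outer = solve-∀

lookup-ext : ∀ {A : Set} {n} {xs ys : Vec A n} → (∀ i → lookup xs i ≡ lookup ys i) → xs ≡ ys
lookup-ext {xs = xs} {ys} eq = trans (sym (tabulate∘lookup xs)) (trans (tabulate-cong eq) (tabulate∘lookup ys))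

≢-flips-both : ∀ {x x' y y' : Bool} → x ≢ x' → y ≢ y' → x ≡ y → x' ≡ y'
≢-flips-both x≢x' y≢y' refl = trans (¬-not (x≢x' ∘ sym)) (sym (¬-not (y≢y' ∘ sym)))

data Parity : ℕ → Set where
  even : ∀ t → Parity (t + t)
  odd  : ∀ t → Parity (suc (t + t))

parity : ∀ n → Parity n
parity zero = even 0
parity (suc n) with parity n
... | even t = odd t
... | odd t = subst Parity (cong suc (+-suc t t)) (even (suc t))

isEven : ℕ → Bool
isEven n with parity n
... | even _ = true
... | odd _ = false

same-parity⇒odd-sum : ∀ k l → isEven k ≡ isEven l → ∃ λ t → k + suc l ≡ suc (t + t)
same-parity⇒odd-sum k l same with parity k | parity l | same
... | even s | even t | _ = s + t , even+odd s t
  where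
  even+odd : ∀ s t → s + s + suc (t + t) ≡ suc (s + t + (s + t))
  even+odd = solve-∀
... | odd s  | odd t  | _ = suc (s + t) , odd+even s t
  where
  odd+even : ∀ s t → suc (s + s) + suc (suc (t + t)) ≡ suc (suc (s + t) + suc (s + t))
  odd+even = solve-∀
... | even _ | odd _  | ()
... | odd _  | even _ | ()

module _ {P : ℕ → Set} (P? : Decidable P) where

  least-witness : ∀ {k} → P k → ∃ λ j → P j × (∀ i → P i → j ≤ i)
  least-witness {k} pk = search k 0 (λ ()) (subst P (sym (+-identityʳ k)) pk)
    where
    search : ∀ fuel j → (∀ {i} → i < j → ¬ P i) → P (fuel + j) → ∃ λ j → P j × (∀ i → P i → j ≤ i)
    search fuel j below p with P? j
    ... | yes pj = j , pj , λ i pi → ≮⇒≥ (λ i<j → below i<j pi)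
    search zero j below p | no ¬pj = contradiction p ¬pj
    search (suc fuel) j below p | no ¬pj =
      search fuel (suc j) below′ (subst P (sym (+-suc fuel j)) p)
      where
      below′ : ∀ {i} → i < suc j → ¬ P i
      below′ i<1+j with m<1+n⇒m<n∨m≡n i<1+j
      ... | inj₁ i<j = below i<j
      ... | inj₂ refl = ¬pj

-- Opaque, so that type checking never evaluates the search for the maximum.
opaque
  maximum-attained : ∀ {k} (R : Fin (suc k) → Fin (suc k) → ℕ → Set)
    → (∀ {u v i j} → R u v i → R u v j → i ≡ j) → (∀ u v → ∃ (R u v))
    → ∃ λ D → (∀ u v i → R u v i → i ≤ D) × (∃₂ λ u v → R u v D)
  maximum-attained {k} R unique total =
    value top , (λ u v i r → subst (_≤ value top) (unique (proj₂ (total u v)) r) (bound (u , v)))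
    , proj₁ top , proj₂ top , proj₂ (total (proj₁ top) (proj₂ top))
    where
    value : Fin (suc k) × Fin (suc k) → ℕ
    value (u , v) = proj₁ (total u v)
    pairs : List (Fin (suc k) × Fin (suc k))
    pairs = cartesianProduct (allFin (suc k)) (allFin (suc k))
    top : Fin (suc k) × Fin (suc k)
    top = argmax value (zero , zero) pairs
    bound : ∀ x → value x ≤ value top
    bound (u , v) = All.lookup (f[xs]≤f[argmax] {f = value} (zero , zero) pairs) (∈-cartesianProduct⁺ (∈-allFin u) (∈-allFin v))

module _ {V : Set} {E : V → V → Set} where

  infixr 5 _++ʷ_

  _++ʷ_ : ∀ {u v w k l} → Walk E u v k → Walk E v w l → Walk E u w (k + l)
  [] ++ʷ q = q
  (e ∷ p) ++ʷ q = e ∷ (p ++ʷ q)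

  castʷ : ∀ {u v k l} → k ≡ l → Walk E u v k → Walk E u v l
  castʷ refl p = p

  length-zero⇒≡ : ∀ {u v} → Walk E u v 0 → u ≡ v
  length-zero⇒≡ [] = refl

  start∈verts : ∀ {u v k} (p : Walk E u v k) → u ∈ verts E p
  start∈verts [] = here refl
  start∈verts (e ∷ p) = here refl

  ∈-++ʷ⁺ʳ : ∀ {u v w k l x} (p : Walk E u v k) (q : Walk E v w l) → x ∈ verts E q → x ∈ verts E (p ++ʷ q)
  ∈-++ʷ⁺ʳ [] q x∈q = x∈q
  ∈-++ʷ⁺ʳ (e ∷ p) q x∈q = there (∈-++ʷ⁺ʳ p q x∈q)

  uncons : ∀ {u v k} → Walk E u v (suc k) → ∃ λ x → E u x × Walk E x v k
  uncons (e ∷ p) = _ , e , p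

  reverseʷ : Symmetric E → ∀ {u v k} → Walk E u v k → Walk E v u k
  reverseʷ sym-E [] = []
  reverseʷ sym-E {k = suc k} (e ∷ p) = castʷ (+-comm k 1) (reverseʷ sym-E p ++ʷ (sym-E e ∷ []))

  walk-preserves : {P : V → Set} → (∀ {x y} → E x y → P x → P y) → ∀ {x y k} → Walk E x y k → P x → P y
  walk-preserves step [] px = px
  walk-preserves step (e ∷ p) px = walk-preserves step p (step e px)

module _ {V : Set} {E : V → V → Set} where

  IsDist-unique : ∀ {u v k l} → IsDist E u v k → IsDist E u v l → k ≡ l
  IsDist-unique (p , p-min) (q , q-min) = ≤-antisym (p-min _ q) (q-min _ p)

  IsDiam-unique : ∀ {D D'} → IsDiam E D → IsDiam E D' → D ≡ D'
  IsDiam-unique (bound , u , v , d) (bound' , u' , v' , d') = ≤-antisym (bound' u v _ d) (bound u' v' _ d')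

  IsHaDist-unique : ∀ {u v k l} → IsHaDist E u v k → IsHaDist E u v l → k ≡ l
  IsHaDist-unique ((p , p-all) , p-min) ((q , q-all) , q-min) = ≤-antisym (p-min _ q q-all) (q-min _ p p-all)

  IsHaDiam-unique : ∀ {D D'} → IsHaDiam E D → IsHaDiam E D' → D ≡ D'
  IsHaDiam-unique (bound , u , v , d) (bound' , u' , v' , d') = ≤-antisym (bound' u v _ d) (bound u' v' _ d')

  IsDist-sym : Symmetric E → ∀ {u v k} → IsDist E u v k → IsDist E v u k
  IsDist-sym sym-E (p , p-min) = reverseʷ sym-E p , λ m q → p-min m (reverseʷ sym-E q)

  antipodal⇔ : ∀ {D u v k} → IsDiam E D → IsDist E u v k → Antipodal E u v ⇔ k ≡ D
  antipodal⇔ diam d = mk⇔ (λ (D' , diam' , d') → trans (IsDist-unique d d') (IsDiam-unique diam' diam))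
                          (λ { refl → _ , diam , d })

  hamAntipodal⇔ : ∀ {D u v k} → IsHaDiam E D → IsHaDist E u v k → HamAntipodal E u v ⇔ k ≡ D
  hamAntipodal⇔ diam d = mk⇔ (λ (D' , diam' , d') → trans (IsHaDist-unique d d') (IsHaDiam-unique diam' diam))
                             (λ { refl → _ , diam , d })

  antipodal-sym : Symmetric E → ∀ {u v} → Antipodal E u v → Antipodal E v u
  antipodal-sym sym-E (D , diam , d) = D , diam , IsDist-sym sym-E d

  0<dist⇒≢ : ∀ {u v k} → 0 < k → IsDist E u v k → u ≢ v
  0<dist⇒≢ 0<k (_ , minimal) refl = <⇒≱ 0<k (minimal 0 [])

  ≢⇒0<dist : ∀ {u v k} → u ≢ v → IsDist E u v k → 0 < k
  ≢⇒0<dist {k = zero} u≢v ([] , _) = contradiction refl u≢v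
  ≢⇒0<dist {k = suc k} _ _ = z<s

  antipodal? : ∀ {d : V → V → ℕ} {D} → (∀ u v → IsDist E u v (d u v)) → IsDiam E D
             → ∀ u v → Dec (Antipodal E u v)
  antipodal? {d} {D} d-ok diam u v =
    map′ (Equivalence.from (antipodal⇔ diam (d-ok u v))) (Equivalence.to (antipodal⇔ diam (d-ok u v))) (d u v ≟ D)

mapʷ : ∀ {V V' : Set} {E : V → V → Set} {E' : V' → V' → Set} (φ : V → V')
     → (∀ {x y} → E x y → E' (φ x) (φ y)) → ∀ {x y k} → Walk E x y k → Walk E' (φ x) (φ y) k
mapʷ φ φ-E [] = []
mapʷ φ φ-E (e ∷ p) = φ-E e ∷ mapʷ φ φ-E p

zip-walks : ∀ {n} {A B : Set} {E : A → A → Set} {F : B → B → Set} {R : Vec A n × B → Vec A n × B → Set}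
  → (∀ {f v f' v'} → (∀ w → E (lookup f w) (lookup f' w)) → F v v' → R (f , v) (f' , v'))
  → ∀ {L f v f' v'} → (∀ w → Walk E (lookup f w) (lookup f' w) L) → Walk F v v' L → Walk R (f , v) (f' , v') L
zip-walks {R = R} step {f = f} {v} components [] =
  subst (λ g → Walk R (f , v) (g , v) 0) (lookup-ext (length-zero⇒≡ ∘ components)) []
zip-walks {E = E} step {suc L} {f} {f' = f'} components (e ∷ p) =
  step {f' = middle} firsts e ∷ zip-walks step rests p
  where
  middle : Vec _ _
  middle = tabulate (λ w → proj₁ (uncons (components w)))
  firsts : ∀ w → E (lookup f w) (lookup middle w)
  firsts w = subst (E _) (sym (lookup∘tabulate _ w)) (proj₁ (proj₂ (uncons (components w))))
  rests : ∀ w → Walk E (lookup middle w) (lookup f' w) L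
  rests w = subst (λ a → Walk E a _ L) (sym (lookup∘tabulate _ w)) (proj₂ (proj₂ (uncons (components w))))

module _ {V : Set} {E : V → V → Set} (sym-E : Symmetric E) where

  bounce : ∀ {z y} → E z y → ∀ h → Walk E z z (h + h)
  bounce e zero = []
  bounce e (suc h) = castʷ (cong suc (sym (+-suc h h))) (e ∷ sym-E e ∷ bounce e h)

  closed-walks-of-every-length≥ : ∀ {z t} → Walk E z z (suc (t + t)) → ∀ x → Walk E z z (suc (t + t) + x)
  closed-walks-of-every-length≥ {t = t} cycle@(e ∷ _) x with parity x
  ... | even h = cycle ++ʷ bounce e h
  ... | odd h = castʷ (lengths t h) (bounce e (suc (t + h)))
    where
    lengths : ∀ t h → suc (t + h) + suc (t + h) ≡ suc (t + t) + suc (h + h)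
    lengths = solve-∀

  walks-of-every-length≥ : ∀ {D z t} → (∀ a b → ∃ λ j → j ≤ D × Walk E a b j) → Walk E z z (suc (t + t))
    → ∀ j a b → Walk E a b (D + D + suc (t + t) + j)
  walks-of-every-length≥ {D} {z} {t} bounded cycle j a b with bounded a z | bounded z b
  ... | j₁ , j₁≤D , p | j₂ , j₂≤D , q with m≤n⇒∃[o]m+o≡n j₁≤D | m≤n⇒∃[o]m+o≡n j₂≤D
  ...   | i₁ , D₁ | i₂ , D₂ = castʷ length (p ++ʷ closed-walks-of-every-length≥ {t = t} cycle (i₁ + i₂ + j) ++ʷ q)
    where
    open ≡-Reasoning
    regroup : ∀ j₁ j₂ i₁ i₂ L j → j₁ + (L + (i₁ + i₂ + j) + j₂) ≡ (j₁ + i₁) + (j₂ + i₂) + L + j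
    regroup = solve-∀
    length : j₁ + (suc (t + t) + (i₁ + i₂ + j) + j₂) ≡ D + D + suc (t + t) + j
    length = begin
      j₁ + (suc (t + t) + (i₁ + i₂ + j) + j₂) ≡⟨ regroup j₁ j₂ i₁ i₂ (suc (t + t)) j ⟩
      (j₁ + i₁) + (j₂ + i₂) + suc (t + t) + j ≡⟨ cong₂ (λ d₁ d₂ → d₁ + d₂ + suc (t + t) + j) D₁ D₂ ⟩
      D + D + suc (t + t) + j                 ∎

module _ {V : Set} {E : V → V → Set} (conn : Connected E) where

  has-neighbour : (∀ u → ∃ λ y → y ≢ u) → ∀ u → ∃ (E u)
  has-neighbour another u with another u
  ... | y , y≢u with conn u y
  ...   | _ , [] = contradiction refl y≢u
  ...   | _ , e ∷ _ = _ , e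

  arbitrarily-long-walks : (∀ u → ∃ (E u)) → ∀ N u v → ∃ λ j → Walk E u v (N + j)
  arbitrarily-long-walks neighbour zero u v = conn u v
  arbitrarily-long-walks neighbour (suc N) u v with neighbour u
  ... | _ , e = map₂ (e ∷_) (arbitrarily-long-walks neighbour N _ v)

module FiniteGraph {k} {E : Fin k → Fin k → Set} (E? : ∀ u v → Dec (E u v)) where
  open import Data.List.Membership.DecPropositional (_≟ᶠ_ {k}) using (_∈?_)

  VisitsAllBut : List (Fin k) → ∀ {u v j} → Walk E u v j → Set
  VisitsAllBut S p = ∀ w → w ∈ S ⊎ w ∈ verts E p

  visitsAllBut? : ∀ S u v j → Dec (Σ (Walk E u v j) (VisitsAllBut S))
  visitsAllBut? S u v zero with u ≟ᶠ v
  ... | no u≢v = no λ { ([] , _) → u≢v refl }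
  ... | yes refl = map′ ([] ,_) (λ { ([] , c) → c }) (all? λ w → w ∈? S ⊎-dec w ∈? (u ∷ []))
  visitsAllBut? S u v (suc j) = map′ extend restrict (any? λ x → E? u x ×-dec visitsAllBut? (u ∷ S) x v j)
    where
    extend : (∃ λ x → E u x × Σ (Walk E x v j) (VisitsAllBut (u ∷ S))) → Σ (Walk E u v (suc j)) (VisitsAllBut S)
    extend (x , e , p , c) = e ∷ p , λ w → shift (c w)
      where
      shift : ∀ {w} → w ∈ u ∷ S ⊎ w ∈ verts E p → w ∈ S ⊎ w ∈ u ∷ verts E p
      shift (inj₁ (here w≡u)) = inj₂ (here w≡u)
      shift (inj₁ (there w∈S)) = inj₁ w∈S
      shift (inj₂ w∈p) = inj₂ (there w∈p)
    restrict : Σ (Walk E u v (suc j)) (VisitsAllBut S) → ∃ λ x → E u x × Σ (Walk E x v j) (VisitsAllBut (u ∷ S))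
    restrict (e ∷ p , c) = _ , e , p , λ w → shift (c w)
      where
      shift : ∀ {w} → w ∈ S ⊎ w ∈ u ∷ verts E p → w ∈ u ∷ S ⊎ w ∈ verts E p
      shift (inj₁ w∈S) = inj₁ (there w∈S)
      shift (inj₂ (here w≡u)) = inj₁ (here w≡u)
      shift (inj₂ (there w∈p)) = inj₂ w∈p

  walk? : ∀ u v j → Dec (Walk E u v j)
  walk? u v j = map′ proj₁ (λ p → p , λ w → inj₁ (∈-allFin w)) (visitsAllBut? (allFin k) u v j)

  visitsAll? : ∀ u v j → Dec (Σ (Walk E u v j) (VisitsAll E))
  visitsAll? u v j = map′ (λ (p , c) → p , λ w → onlyWalk (c w)) (λ (p , c) → p , λ w → inj₂ (c w)) (visitsAllBut? [] u v j)
    where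
    onlyWalk : ∀ {w} {p : Walk E u v j} → w ∈ [] ⊎ w ∈ verts E p → w ∈ verts E p
    onlyWalk (inj₂ w∈p) = w∈p

  module _ (conn : Connected E) where

    walk-through : ∀ (L : List (Fin k)) u v → ∃ λ j → Σ (Walk E u v j) λ p → ∀ {w} → w ∈ L → w ∈ verts E p
    walk-through [] u v = proj₁ (conn u v) , proj₂ (conn u v) , λ ()
    walk-through (x ∷ L) u v with conn u x | walk-through L x v
    ... | _ , p | _ , q , q-through = _ , p ++ʷ q , λ
      { (here refl) → ∈-++ʷ⁺ʳ p q (start∈verts q)
      ; (there w∈L) → ∈-++ʷ⁺ʳ p q (q-through w∈L) }

    distance : ∀ u v → ∃ (IsDist E u v)
    distance u v = least-witness (walk? u v) (proj₂ (conn u v))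

    haDistance : ∀ u v → ∃ (IsHaDist E u v)
    haDistance u v with walk-through (allFin k) u v
    ... | _ , p , p-through with least-witness (visitsAll? u v) (p , λ w → p-through (∈-allFin w))
    ...   | j , q , q-min = j , q , λ m q′ q′-all → q-min m (q′ , q′-all)

module _ {k} {E : Fin (suc k) → Fin (suc k) → Set} (E? : ∀ u v → Dec (E u v)) (conn : Connected E) where
  open FiniteGraph E?

  diameter : ∃ (IsDiam E)
  diameter = maximum-attained (IsDist E) IsDist-unique (distance conn)

  haDiameter : ∃ (IsHaDiam E)
  haDiameter = maximum-attained (IsHaDist E) IsHaDist-unique (haDistance conn)

  bounded-walks : ∃ λ D → ∀ u v → ∃ λ j → j ≤ D × Walk E u v j
  bounded-walks = proj₁ diameter , λ u v →
    let (j , d) = distance conn u v in j , proj₁ (proj₂ diameter) u v j d , proj₁ d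

odd-closed-walk : ∀ {k} {E : Fin k → Fin k → Set} → (∀ u v → Dec (E u v)) → Symmetric E
  → Connected E → ¬ Bipartite E → ∀ z → ∃ λ t → Walk E z z (suc (t + t))
odd-closed-walk {k} {E} E? sym-E conn not-bipartite z = close monochromatic-edge?
  where
  colour : Fin k → Bool
  colour u = isEven (proj₁ (conn z u))
  monochromatic-edge? : Dec (∃₂ λ u w → E u w × colour u ≡ colour w)
  monochromatic-edge? = any? λ u → any? λ w → E? u w ×-dec colour u ≟ᵇ colour w
  close : Dec (∃₂ λ u w → E u w × colour u ≡ colour w) → ∃ λ t → Walk E z z (suc (t + t))
  close (no none) = contradiction (colour , λ u w e same → none (u , w , e , same)) not-bipartite
  close (yes (u , w , e , same)) with conn z u | conn z w | same-parity⇒odd-sum _ _ same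
  ... | _ , p | _ , q | t , odd-length = t , castʷ odd-length (p ++ʷ e ∷ reverseʷ sym-E q)

non-bipartite⇒long-walks : ∀ {k} {E : Fin (suc k) → Fin (suc k) → Set} → (∀ u v → Dec (E u v))
  → Symmetric E → Connected E → ¬ Bipartite E → ∃ λ N → ∀ j a b → Walk E a b (N + j)
non-bipartite⇒long-walks E? sym-E conn not-bipartite =
  let (D , bounded) = bounded-walks E? conn
      (t , cycle) = odd-closed-walk E? sym-E conn not-bipartite zero
  in D + D + suc (t + t) , walks-of-every-length≥ sym-E {t = t} bounded cycle

module WreathWalks {n m} (G : SimpleGraph n) (H : SimpleGraph m) where

  W : Vec (Fin m) n × Fin n → Vec (Fin m) n × Fin n → Set
  W = WreathAdj G H

  lamp-step : ∀ {f v b} → Adj H (lookup f v) b → W (f , v) (f [ v ]≔ b , v)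
  lamp-step {f} {v} e =
    inj₁ (refl , (λ w w≢v → sym (lookup∘update′ w≢v f _)) , subst (Adj H _) (sym (lookup∘update v f _)) e)

  lamp-walk : ∀ {f v b k} → Walk (Adj H) (lookup f v) b k → Walk W (f , v) (f [ v ]≔ b , v) k
  lamp-walk {f} {v} [] = subst (λ g → Walk W (f , v) (g , v) 0) (sym ([]≔-lookup f v)) []
  lamp-walk {f} {v} {b} (_∷_ {v = c} e q) =
    lamp-step e ∷ subst (λ g → Walk W (f [ v ]≔ c , v) (g , v) _) ([]≔-idempotent f v)
                        (lamp-walk (subst (λ a → Walk (Adj H) a b _) (sym (lookup∘update v f c)) q))

  record Shadow (f : Vec (Fin m) n) (v : Fin n) (f' : Vec (Fin m) n) (v' : Fin n) (k : ℕ) : Set where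
    field
      baseLength : ℕ
      base : Walk (Adj G) v v' baseLength
      lampLength : Fin n → ℕ
      lamp : ∀ w → Walk (Adj H) (lookup f w) (lookup f' w) (lampLength w)
      length-≡ : baseLength + sum lampLength ≡ k
      visits-changed : ∀ w → w ∈ verts (Adj G) base ⊎ lookup f w ≡ lookup f' w

  shadow-stay : ∀ {f v} → Shadow f v f v 0
  shadow-stay = record
    { baseLength = 0 ; base = [] ; lampLength = λ _ → 0 ; lamp = λ _ → []
    ; length-≡ = sum-replicate-zero n ; visits-changed = λ _ → inj₂ refl }

  shadow-move : ∀ {f v u f' v' k} → Adj G v u → Shadow f u f' v' k → Shadow f v f' v' (suc k)
  shadow-move e s = record
    { baseLength = suc baseLength ; base = e ∷ base ; lampLength = lampLength ; lamp = lamp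
    ; length-≡ = cong suc length-≡ ; visits-changed = λ w → map₁ there (visits-changed w) }
    where open Shadow s

  shadow-switch : ∀ {f g v f' v' k} → (∀ w → w ≢ v → lookup f w ≡ lookup g w) → Adj H (lookup f v) (lookup g v)
    → Shadow g v f' v' k → Shadow f v f' v' (suc k)
  shadow-switch {f} {g} {v} {f'} same e s = record
    { baseLength = baseLength ; base = base ; lampLength = lampLength′ ; lamp = lamp′
    ; length-≡ = length-≡′ ; visits-changed = visits-changed′ }
    where
    open Shadow s
    lampLength′ : Fin n → ℕ
    lampLength′ = updateAt lampLength v suc
    lamp′ : ∀ w → Walk (Adj H) (lookup f w) (lookup f' w) (lampLength′ w)
    lamp′ w with w ≟ᶠ v
    ... | yes refl = castʷ (sym (updateAt-updates v lampLength)) (e ∷ lamp v)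
    ... | no w≢v = castʷ (sym (updateAt-minimal w v lampLength w≢v)) (subst (λ a → Walk (Adj H) a _ _) (sym (same w w≢v)) (lamp w))
    sum-lampLength′ : sum lampLength′ ≡ suc (sum lampLength)
    sum-lampLength′ = +-cancelʳ-≡ (lampLength v) _ _ (begin
      sum lampLength′ + lampLength v        ≡⟨ sum-exchange v (λ w w≢v → updateAt-minimal w v lampLength w≢v) ⟩
      sum lampLength + lampLength′ v        ≡⟨ cong (sum lampLength +_) (updateAt-updates v lampLength) ⟩
      sum lampLength + suc (lampLength v)   ≡⟨ +-suc _ _ ⟩
      suc (sum lampLength) + lampLength v   ∎)
      where open ≡-Reasoning
    length-≡′ : baseLength + sum lampLength′ ≡ suc _
    length-≡′ = trans (cong (baseLength +_) sum-lampLength′) (trans (+-suc baseLength _) (cong suc length-≡))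
    visits-changed′ : ∀ w → w ∈ verts (Adj G) base ⊎ lookup f w ≡ lookup f' w
    visits-changed′ w with visits-changed w | w ≟ᶠ v
    ... | inj₁ w∈base | _ = inj₁ w∈base
    ... | inj₂ _ | yes refl = inj₁ (start∈verts base)
    ... | inj₂ g≡f' | no w≢v = inj₂ (trans (same w w≢v) g≡f')

  shadow : ∀ {f v f' v' k} → Walk W (f , v) (f' , v') k → Shadow f v f' v' k
  shadow [] = shadow-stay
  shadow (inj₁ (refl , same , e) ∷ P) = shadow-switch same e (shadow P)
  shadow (inj₂ (refl , e) ∷ P) = shadow-move e (shadow P)

module WreathMetric {n m} (G : SimpleGraph n) (H : SimpleGraph m)
  {dH : Fin m → Fin m → ℕ} (dH-ok : ∀ a b → IsDist (Adj H) a b (dH a b))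
  {dHa : Fin n → Fin n → ℕ} (dHa-ok : ∀ u v → IsHaDist (Adj G) u v (dHa u v)) where
  open WreathWalks G H

  cost : Vec (Fin m) n → Vec (Fin m) n → ℕ
  cost f f' = sum λ w → dH (lookup f w) (lookup f' w)

  dH-self : ∀ a → dH a a ≡ 0
  dH-self a = n≤0⇒n≡0 (proj₂ (dH-ok a a) 0 [])

  cost-self : ∀ f → cost f f ≡ 0
  cost-self f = trans (sum-cong-≗ (dH-self ∘ lookup f)) (sum-replicate-zero n)

  cost-fix : ∀ f f' v → cost f f' ≡ dH (lookup f v) (lookup f' v) + cost (f [ v ]≔ lookup f' v) f'
  cost-fix f f' v = +-cancelʳ-≡ 0 _ _ (begin
    cost f f' + 0                             ≡⟨ cong (cost f f' +_) (sym (dH-self (lookup f' v))) ⟩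
    cost f f' + dH (lookup f' v) (lookup f' v) ≡⟨ cong (λ a → cost f f' + dH a (lookup f' v)) (sym (lookup∘update v f _)) ⟩
    cost f f' + dH (lookup f₁ v) (lookup f' v) ≡⟨ sum-exchange {f = λ w → dH (lookup f w) (lookup f' w)} v agree ⟩
    cost f₁ f' + dH (lookup f v) (lookup f' v) ≡⟨ +-comm (cost f₁ f') _ ⟩
    dH (lookup f v) (lookup f' v) + cost f₁ f' ≡⟨ +-identityʳ _ ⟨
    dH (lookup f v) (lookup f' v) + cost f₁ f' + 0 ∎)
    where
    open ≡-Reasoning
    f₁ : Vec (Fin m) n
    f₁ = f [ v ]≔ lookup f' v
    agree : ∀ w → w ≢ v → dH (lookup f w) (lookup f' w) ≡ dH (lookup f₁ w) (lookup f' w)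
    agree w w≢v = cong (λ a → dH a (lookup f' w)) (sym (lookup∘update′ w≢v f _))

  lift-walk : ∀ {v v' L f f'} (p : Walk (Adj G) v v' L) → (∀ w → w ∈ verts (Adj G) p ⊎ lookup f w ≡ lookup f' w)
       → Walk W (f , v) (f' , v') (L + cost f f')
  lift-walk {v} {f = f} {f'} [] changed =
    castʷ length (subst (λ g → Walk W (f , v) (g , v) (dH (lookup f v) (lookup f' v))) fixed
                         (lamp-walk (proj₁ (dH-ok (lookup f v) (lookup f' v)))))
    where
    fixed : f [ v ]≔ lookup f' v ≡ f'
    fixed = lookup-ext λ w → case-on w
      where
      case-on : ∀ w → lookup (f [ v ]≔ lookup f' v) w ≡ lookup f' w
      case-on w with w ≟ᶠ v | changed w
      ... | yes refl | _ = lookup∘update v f _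
      ... | no w≢v | inj₁ (here w≡v) = contradiction w≡v w≢v
      ... | no w≢v | inj₂ same = trans (lookup∘update′ w≢v f _) same
    length : dH (lookup f v) (lookup f' v) ≡ 0 + cost f f'
    length = sym (begin
      cost f f'                                                   ≡⟨ cost-fix f f' v ⟩
      dH (lookup f v) (lookup f' v) + cost (f [ v ]≔ lookup f' v) f' ≡⟨ cong (λ g → dH (lookup f v) (lookup f' v) + cost g f') fixed ⟩
      dH (lookup f v) (lookup f' v) + cost f' f'                  ≡⟨ cong (dH (lookup f v) (lookup f' v) +_) (cost-self f') ⟩
      dH (lookup f v) (lookup f' v) + 0                           ≡⟨ +-identityʳ _ ⟩
      dH (lookup f v) (lookup f' v)                               ∎)
      where open ≡-Reasoning
  lift-walk {v} {L = suc L} {f} {f'} (e ∷ p) changed =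
    castʷ length (lamp-walk (proj₁ (dH-ok _ _)) ++ʷ inj₂ (refl , e) ∷ lift-walk p changed′)
    where
    changed′ : ∀ w → w ∈ verts (Adj G) p ⊎ lookup (f [ v ]≔ lookup f' v) w ≡ lookup f' w
    changed′ w with w ≟ᶠ v | changed w
    ... | yes refl | _ = inj₂ (lookup∘update v f _)
    ... | no w≢v | inj₁ (here w≡v) = contradiction w≡v w≢v
    ... | no w≢v | inj₁ (there w∈p) = inj₁ w∈p
    ... | no w≢v | inj₂ same = inj₂ (trans (lookup∘update′ w≢v f _) same)
    length : dH (lookup f v) (lookup f' v) + suc (L + cost (f [ v ]≔ lookup f' v) f') ≡ suc L + cost f f'
    length = trans (shuffle _ L _) (cong (λ c → suc L + c) (sym (cost-fix f f' v)))
      where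
      shuffle : ∀ a L c → a + suc (L + c) ≡ suc L + (a + c)
      shuffle = solve-∀

  wreath-walk : ∀ f v f' v' → Walk W (f , v) (f' , v') (dHa v v' + cost f f')
  wreath-walk f v f' v' = lift-walk (proj₁ (proj₁ (dHa-ok v v'))) (inj₁ ∘ proj₂ (proj₁ (dHa-ok v v')))

  wreath-dist : ∀ {f v f' v'} → (∀ w → lookup f w ≢ lookup f' w)
              → IsDist W (f , v) (f' , v') (dHa v v' + cost f f')
  wreath-dist {f} {v} {f'} {v'} differ = wreath-walk f v f' v' , shortest
    where
    shortest : ∀ k → Walk W (f , v) (f' , v') k → dHa v v' + cost f f' ≤ k
    shortest k P = subst (dHa v v' + cost f f' ≤_) length-≡
      (+-mono-≤ (proj₂ (dHa-ok v v') baseLength base visits-all)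
                (sum-mono-≤ λ w → proj₂ (dH-ok _ _) (lampLength w) (lamp w)))
      where
      open Shadow (shadow P)
      visits-all : VisitsAll (Adj G) base
      visits-all w = [ (λ w∈base → w∈base) , (λ same → contradiction same (differ w)) ]′ (visits-changed w)

  module WreathAntipodal {DH} (DH-ok : IsDiam (Adj H) DH) (0<DH : 0 < DH) {DHa} (DHa-ok : IsHaDiam (Adj G) DHa) where

    maxCost : ℕ
    maxCost = sum {n} λ _ → DH

    dH≤DH : ∀ a b → dH a b ≤ DH
    dH≤DH a b = proj₁ DH-ok a b _ (dH-ok a b)

    dHa≤DHa : ∀ u v → dHa u v ≤ DHa
    dHa≤DHa u v = proj₁ DHa-ok u v _ (dHa-ok u v)

    cost≤maxCost : ∀ f f' → cost f f' ≤ maxCost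
    cost≤maxCost f f' = sum-mono-≤ {n} λ w → dH≤DH (lookup f w) (lookup f' w)

    wreath-diam : IsDiam W (DHa + maxCost)
    wreath-diam = bounded , farthest (proj₂ DH-ok) (proj₂ DHa-ok)
      where
      bounded : ∀ x y k → IsDist W x y k → k ≤ DHa + maxCost
      bounded (f , v) (f' , v') k (_ , shortest) =
        ≤-trans (shortest _ (wreath-walk f v f' v')) (+-mono-≤ (dHa≤DHa v v') (cost≤maxCost f f'))
      farthest : (∃₂ λ a b → IsDist (Adj H) a b DH) → (∃₂ λ u u' → IsHaDist (Adj G) u u' DHa)
               → ∃₂ λ x y → IsDist W x y (DHa + maxCost)
      farthest (a , b , ab) (u , u' , uu') = (replicate n a , u) , (replicate n b , u') ,
        subst (IsDist W _ _) (cong₂ _+_ (IsHaDist-unique (dHa-ok u u') uu') (sum-cong-≗ all-far)) (wreath-dist differ)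
        where
        all-far : ∀ w → dH (lookup (replicate n a) w) (lookup (replicate n b) w) ≡ DH
        all-far w = trans (cong₂ dH (lookup-replicate w a) (lookup-replicate w b)) (IsDist-unique (dH-ok a b) ab)
        differ : ∀ w → lookup (replicate n a) w ≢ lookup (replicate n b) w
        differ w = 0<dist⇒≢ 0<DH (subst (IsDist (Adj H) _ _) (all-far w) (dH-ok _ _))

    antipodal-wreath⁺ : ∀ {f v f' v'} → (∀ w → Antipodal (Adj H) (lookup f w) (lookup f' w))
                      → HamAntipodal (Adj G) v v' → Antipodal W (f , v) (f' , v')
    antipodal-wreath⁺ {f} {v} {f'} {v'} lamps base =
      Equivalence.from (antipodal⇔ wreath-diam (wreath-dist differ)) (cong₂ _+_ base-far (sum-cong-≗ lamps-far))
      where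
      lamps-far : ∀ w → dH (lookup f w) (lookup f' w) ≡ DH
      lamps-far w = Equivalence.to (antipodal⇔ DH-ok (dH-ok _ _)) (lamps w)
      base-far : dHa v v' ≡ DHa
      base-far = Equivalence.to (hamAntipodal⇔ DHa-ok (dHa-ok v v')) base
      differ : ∀ w → lookup f w ≢ lookup f' w
      differ w = 0<dist⇒≢ 0<DH (subst (IsDist (Adj H) _ _) (lamps-far w) (dH-ok _ _))

    antipodal-wreath⁻ : ∀ {f v f' v'} → Antipodal W (f , v) (f' , v')
                      → (∀ w → Antipodal (Adj H) (lookup f w) (lookup f' w)) × HamAntipodal (Adj G) v v'
    antipodal-wreath⁻ {f} {v} {f'} {v'} (D , diam , (_ , shortest)) =
      (λ w → Equivalence.from (antipodal⇔ DH-ok (dH-ok _ _)) (lamps-far w)) ,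
      Equivalence.from (hamAntipodal⇔ DHa-ok (dHa-ok v v')) (proj₁ far)
      where
      reaches-max : dHa v v' + cost f f' ≡ DHa + maxCost
      reaches-max = ≤-antisym (+-mono-≤ (dHa≤DHa v v') (cost≤maxCost f f'))
        (subst (_≤ _) (IsDiam-unique diam wreath-diam) (shortest _ (wreath-walk f v f' v')))
      far : dHa v v' ≡ DHa × cost f f' ≡ maxCost
      far = +-≤-≡-split (dHa≤DHa v v') (cost≤maxCost f f') reaches-max
      lamps-far : ∀ w → dH (lookup f w) (lookup f' w) ≡ DH
      lamps-far = sum-≡⇒≗ (λ w → dH≤DH _ _) (proj₂ far)

    connected-antipodal⇒connected-antipodalᴴ : Fin n → Connected (Antipodal W) → Connected (Antipodal (Adj H))
    connected-antipodal⇒connected-antipodalᴴ w conn a b with conn (replicate n a , w) (replicate n b , w)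
    ... | k , P = k , subst₂ (λ a′ b′ → Walk (Antipodal (Adj H)) a′ b′ k) (lookup-replicate w a) (lookup-replicate w b)
                    (mapʷ (λ x → lookup (proj₁ x) w) (λ e → proj₁ (antipodal-wreath⁻ e) w) P)

    connected-antipodal⇒connected-hamAntipodalᴳ : Fin m → Connected (Antipodal W) → Connected (HamAntipodal (Adj G))
    connected-antipodal⇒connected-hamAntipodalᴳ a conn u v =
      _ , mapʷ proj₂ (proj₂ ∘ antipodal-wreath⁻) (proj₂ (conn (replicate n a , u) (replicate n a , v)))

    bipartite-antipodalᴴ⇒disconnected : ∀ {w₀ w₁} → w₀ ≢ w₁ → Bipartite (Antipodal (Adj H)) → ¬ Connected (Antipodal W)
    bipartite-antipodalᴴ⇒disconnected {w₀} {w₁} w₀≢w₁ (colour , proper) conn with proj₂ DH-ok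
    ... | a , b , ab = proper a b (DH , DH-ok , ab) (begin
      colour a                           ≡⟨ cong colour (lookup-replicate w₀ a) ⟨
      colour (lookup (replicate n a) w₀) ≡⟨ cong colour (lookup∘update′ w₀≢w₁ (replicate n a) b) ⟨
      colour (lookup flipped w₀)         ≡⟨ walk-preserves step (proj₂ (conn (replicate n a , w₀) (flipped , w₀))) monochrome ⟩
      colour (lookup flipped w₁)         ≡⟨ cong colour (lookup∘update w₁ (replicate n a) b) ⟩
      colour b                           ∎)
      where
      open ≡-Reasoning
      flipped : Vec (Fin m) n
      flipped = replicate n a [ w₁ ]≔ b
      Balanced : Vec (Fin m) n × Fin n → Set
      Balanced (f , _) = colour (lookup f w₀) ≡ colour (lookup f w₁)
      step : ∀ {x y} → Antipodal W x y → Balanced x → Balanced y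
      step e = let lamps = proj₁ (antipodal-wreath⁻ e) in ≢-flips-both (proper _ _ (lamps w₀)) (proper _ _ (lamps w₁))
      monochrome : Balanced (replicate n a , w₀)
      monochrome = cong colour (trans (lookup-replicate w₀ a) (sym (lookup-replicate w₁ a)))

    connected-antipodal : (∃ λ N → ∀ j a b → Walk (Antipodal (Adj H)) a b (N + j))
      → Connected (HamAntipodal (Adj G)) → (∀ u → ∃ (HamAntipodal (Adj G) u)) → Connected (Antipodal W)
    connected-antipodal (N , long-lamp-walks) conn-base neighbour (f , v) (f' , v')
      with arbitrarily-long-walks conn-base neighbour N v v'
    ... | j , p = N + j , zip-walks antipodal-wreath⁺ (λ w → long-lamp-walks j (lookup f w) (lookup f' w)) p

proposition4p21 : ∀ {n m} (G : SimpleGraph n) (H : SimpleGraph m)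
    → 2 ≤ n → 2 ≤ m → Connected (Adj G) → Connected (Adj H)
    → Connected (Antipodal (WreathAdj G H))
      ⇔ (Connected (Antipodal (Adj H)) × Connected (HamAntipodal (Adj G))
          × ¬ Bipartite (Antipodal (Adj H)))
proposition4p21 G H (s≤s (s≤s _)) (s≤s (s≤s _)) connG connH = mk⇔
  (λ conn → connected-antipodal⇒connected-antipodalᴴ zero conn
          , connected-antipodal⇒connected-hamAntipodalᴳ zero conn
          , λ bipartite → bipartite-antipodalᴴ⇒disconnected {zero} {suc zero} (λ ()) bipartite conn)
  (λ (connᴴ , connᴳ , not-bipartite) → connected-antipodal
      (non-bipartite⇒long-walks (antipodal? dH-ok DH-ok) (antipodal-sym (SimpleGraph.sym H)) connᴴ not-bipartite)
      connᴳ (has-neighbour connᴳ λ u → punchIn u zero , punchInᵢ≢i u zero))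
  where
  open FiniteGraph
  dH-ok : ∀ a b → IsDist (Adj H) a b (proj₁ (distance (adj? H) connH a b))
  dH-ok a b = proj₂ (distance (adj? H) connH a b)
  dHa-ok : ∀ u v → IsHaDist (Adj G) u v (proj₁ (haDistance (adj? G) connG u v))
  dHa-ok u v = proj₂ (haDistance (adj? G) connG u v)
  DH-ok : IsDiam (Adj H) (proj₁ (diameter (adj? H) connH))
  DH-ok = proj₂ (diameter (adj? H) connH)
  0<DH : 0 < proj₁ (diameter (adj? H) connH)
  0<DH = ≤-trans (≢⇒0<dist (λ ()) (dH-ok zero (suc zero))) (proj₁ DH-ok _ _ _ (dH-ok zero (suc zero)))
  open WreathMetric G H dH-ok dHa-ok
  open WreathAntipodal DH-ok 0<DH (proj₂ (haDiameter (adj? G) connG))
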